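{- Let $n\ge3$ and $d\ge0$ be integers and $G\in\hat{\mathcal{K}}_{n,d}$ with deficiency $k\ge1$. Then $G$ contains a core stretched clique $G'\in\hat{\mathcal{K}}_{n,d-k}$. Moreover, $G$ can be obtained from $G'$ by 2-stretching $k$ vertices.
   Context: Stretched cliques: stretching a vertex $v$ with sets $A_1,\dots,A_m\subseteq\Gamma(v)$ (possibly empty, union $\Gamma(v)$) replaces $v$ by new vertices $v_0,\dots,v_m$, joining each $v_j$ ($j\in[m]$) to $v_0$ and to all of $A_j$; $m=2$ gives a 2-stretching. $\mathcal{K}_{n,d}$ is the set of graphs obtained from $K_n$ (vertex set $[n]$) by 2-stretching $d$ of its original vertices, each at most once. For $G\in\mathcal{K}_{n,d}$, $D(G)$ is the set of stretched original vertices; for $i\in D(G)$, $i_0$ is a hub and $i_1,i_2$ are wings. The vertices associated with $i\in[n]$ are $i_0,i_1,i_2$ if $i\in D(G)$ and $i$ otherwise. For a wing $i_\ell$, $\tilde\Gamma_G(i_\ell)$ is the set of $j\in[n]\setminus\{i\}$ such that $i_\ell$ is adjacent to a vertex associated with $j$; $\tilde{\mathcal{K}}_{n,d}$ is the set of $G\in\mathcal{K}_{n,d}$ with $\tilde\Gamma_G(i_\ell)\subsetneq[n]\setminus\{i\}$ for all $i\in D(G)$, $\ell\in\{1,2\}$. $\hat{\mathcal{K}}_{n,d}$ is the set of $G\in\mathcal{K}_{n,d}$ such that for all distinct $i,j\in D(G)$ exactly one of $\{i_1,j_1\},\{i_1,j_2\},\{i_2,j_1\},\{i_2,j_2\}$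 is an edge. A stretched-clique decomposition of $G\in\mathcal{K}_{n,d}$ is a partition $\{C_0,C_1,\dots,C_k\}$ of $V(G)$ such that $C_0$ induces a graph in $\tilde{\mathcal{K}}_{n,d-k}$ and each $C_1,\dots,C_k$ is an edge of $G$ consisting of a hub vertex and a wing vertex; the subgraph induced by $C_0$ is called a core stretched clique of $G$. The deficiency of $G$ is the minimum $k$ over all stretched-clique decompositions. -}

module Defs where

open import Data.Nat using (ℕ; zero; suc; _+_; _≤_; _∸_)
open import Data.Fin using (Fin; _≟_)
open import Data.Bool using (Bool; true; false; _∧_; _∨_; not; if_then_else_)
open import Data.List using (List; []; _∷_; length; map)
open import Data.Nat.ListAction using (sum)
open import Data.Product using (Σ; Σ-syntax; ∃; ∃-syntax; _×_; _,_; proj₁; proj₂)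
open import Relation.Nullary using (does; ¬_)
open import Relation.Binary.PropositionalEquality using (_≡_)
import Data.List.Membership.Propositional

-- For the original vertex set [n] = Fin n, a graph obtained
-- from K_n by 2-stretchings has vertices among
--   orig i      (an unstretched original vertex i),
--   hub i       (i_0),
--   wing i s    (i_1 for s = one, i_2 for s = two).

data Side : Set where
  one two : Side

data Vtx (n : ℕ) : Set where
  orig : Fin n → Vtx n
  hub  : Fin n → Vtx n
  wing : Fin n → Side → Vtx n

eqSide : Side → Side → Bool
eqSide one one = true
eqSide two two = true
eqSide _   _   = false

eqV : ∀ {n} → Vtx n → Vtx n → Bool
eqV (orig i)   (orig j)   = does (i ≟ j)
eqV (hub i)    (hub j)    = does (i ≟ j)
eqV (wing i s) (wing j t) = does (i ≟ j) ∧ eqSide s t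
eqV _          _          = false

isHub : ∀ {n} → Vtx n → Bool
isHub (hub _) = true
isHub _       = false

isWing : ∀ {n} → Vtx n → Bool
isWing (wing _ _) = true
isWing _          = false

-- Labelled graphs on these vertices.  st i = true iff i ∈ D(G)
-- (i has been stretched).  The vertex set is determined by st:
-- orig i is present iff i is unstretched, hub/wings of i iff stretched.

record Graph (n : ℕ) : Set where
  field
    st : Fin n → Bool
    E  : Vtx n → Vtx n → Bool
open Graph public

present : ∀ {n} → Graph n → Vtx n → Bool
present G (orig i)   = not (st G i)
present G (hub i)    = st G i
present G (wing i _) = st G i

_≗G_ : ∀ {n} → Graph n → Graph n → Set
G ≗G H = (∀ i → st G i ≡ st H i) × (∀ u v → E G u v ≡ E H u v)

complete : (n : ℕ) → Graph n
st (complete n) _ = false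
E  (complete n) (orig i) (orig j) = not (does (i ≟ j))
E  (complete n) _ _ = false

isOrigOf : ∀ {n} → Fin n → Vtx n → Bool
isOrigOf i (orig j) = does (j ≟ i)
isOrigOf i _        = false

isHubOf : ∀ {n} → Fin n → Vtx n → Bool
isHubOf i (hub j) = does (j ≟ i)
isHubOf i _       = false

newE : ∀ {n} → Fin n → (Side → Vtx n → Bool) → Vtx n → Vtx n → Bool
newE i A (wing j s) v = does (j ≟ i) ∧ (isHubOf i v ∨ A s v)
newE i A _          v = false

stretch : ∀ {n} → Graph n → Fin n → (Side → Vtx n → Bool) → Graph n
st (stretch G i A) j = st G j ∨ does (j ≟ i)
E  (stretch G i A) u v =
  (E G u v ∧ not (isOrigOf i u) ∧ not (isOrigOf i v))
  ∨ newE i A u v ∨ newE i A v u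

data Stretches {n : ℕ} : ℕ → Graph n → Graph n → Set where
  done : ∀ {G H} → G ≗G H → Stretches zero G H
  step : ∀ {k G H} (i : Fin n) (A : Side → Vtx n → Bool) →
         st G i ≡ false →
         (∀ u → E G (orig i) u ≡ (A one u ∨ A two u)) →
         Stretches k (stretch G i A) H →
         Stretches (suc k) G H

K : (n d : ℕ) → Graph n → Set
K n d G = Stretches d (complete n) G

assoc : ∀ {n} → Graph n → Fin n → Vtx n → Bool
assoc G j (orig i)   = not (st G j) ∧ does (i ≟ j)
assoc G j (hub i)    = st G j ∧ does (i ≟ j)
assoc G j (wing i _) = st G j ∧ does (i ≟ j)

-- condition defining 𝒦̃: for every wing i_ℓ, Γ̃(i_ℓ) ⊊ [n]∖{i},
-- i.e. some j ≠ i has no associated vertex adjacent to i_ℓ.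
TildeCond : ∀ {n} → Graph n → Set
TildeCond {n} G = ∀ (i : Fin n) (s : Side) → st G i ≡ true →
  Σ[ j ∈ Fin n ] (¬ (j ≡ i) × (∀ v → assoc G j v ≡ true → E G (wing i s) v ≡ false))

KTilde : (n d : ℕ) → Graph n → Set
KTilde n d G = K n d G × TildeCond G

b2n : Bool → ℕ
b2n true  = 1
b2n false = 0

HatCond : ∀ {n} → Graph n → Set
HatCond {n} G = ∀ (i j : Fin n) → ¬ (i ≡ j) → st G i ≡ true → st G j ≡ true →
  b2n (E G (wing i one) (wing j one)) + b2n (E G (wing i one) (wing j two))
  + b2n (E G (wing i two) (wing j one)) + b2n (E G (wing i two) (wing j two)) ≡ 1

KHat : (n d : ℕ) → Graph n → Set
KHat n d G = K n d G × HatCond G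

-- Partitions {C_0, C_1, ..., C_k} of V(G) with each C_j (j ≥ 1) an edge
-- {hub, wing} of G.  C_j (j ≥ 1) are given as a list of ordered pairs
-- (hub, wing) of length k.

occ : ∀ {n} → Vtx n → Vtx n × Vtx n → ℕ
occ v (a , b) = b2n (eqV v a) + b2n (eqV v b)

record Decomp {n : ℕ} (G : Graph n) (k : ℕ) : Set where
  field
    C0    : Vtx n → Bool
    parts : List (Vtx n × Vtx n)
    len   : length parts ≡ k
    C0⊆V  : ∀ v → C0 v ≡ true → present G v ≡ true
    partsEdges : ∀ p → p Data.List.Membership.Propositional.∈ parts →
                 (isHub (proj₁ p) ≡ true) × (isWing (proj₂ p) ≡ true)
                 × (E G (proj₁ p) (proj₂ p) ≡ true)
    cover : ∀ v → present G v ≡ true →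
            b2n (C0 v) + sum (map (occ v) parts) ≡ 1
open Decomp public

-- The graph induced by C_0, with its canonical labelling as a graph on
-- [n]: i is stretched in it iff i_0 ∈ C_0; if i ∈ D(G) but i_0 ∉ C_0,
-- the unique remaining wing of i plays the role of the original vertex i.
liftV : ∀ {n} → Graph n → (Vtx n → Bool) → Vtx n → Vtx n
liftV G C (orig i) = if st G i
                     then (if C (wing i one) then wing i one else wing i two)
                     else orig i
liftV G C v = v

core : ∀ {n} {G : Graph n} {k} → Decomp G k → Graph n
core {G = G} D = record { st = stC ; E = EC }
  where
  stC : _ → Bool
  stC i = st G i ∧ C0 D (hub i)
  H0 : Graph _
  H0 = record { st = stC ; E = λ _ _ → false }
  EC : _ → _ → Bool
  EC u v = present H0 u ∧ present H0 v ∧ E G (liftV G (C0 D) u) (liftV G (C0 D) v)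

SCDecomp : (n d : ℕ) → Graph n → ℕ → Set
SCDecomp n d G k = Σ[ D ∈ Decomp G k ] KTilde n (d ∸ k) (core D)

Deficiency : (n d : ℕ) → Graph n → ℕ → Set
Deficiency n d G k = SCDecomp n d G k × (∀ k' → SCDecomp n d G k' → k ≤ k')

{-# OPTIONS --safe #-}
-- Each part C_j is an edge {i₀, i_p} (a hub is adjacent only to its own wings), and the
-- cover condition puts the other wing i_q into C₀, where it plays the unstretched vertex i.
-- Since the core is again a stretched clique, i_q has in G a neighbour associated with every
-- j ≠ i; by the 𝒦̂ condition i_p then has no wing neighbours, so Γ(i_p) ∖ {i₀} ⊆ Γ(i_q).
-- Hence 2-stretching i in the core with A_s = Γ(i_s) ∖ {i₀} restores both wings, and doing
-- so for the k parts in turn rebuilds G. The 𝒦̂ condition passes to the core because it only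
-- involves wing–wing edges, which the core keeps.
module Submission where

open import Defs
open import Data.Bool using (Bool; true; false; _∧_; _∨_; not)
open import Data.Bool.Properties
  using (∧-assoc; ∧-comm; ∨-comm; ∧-identityʳ; ∨-identityʳ; ∧-zeroʳ; ∨-zeroʳ)
open import Data.Empty using (⊥; ⊥-elim)
open import Data.Fin using (Fin; _≟_)
open import Data.List using (List; []; _∷_; length; map)
open import Data.List.Membership.Propositional using (_∈_)
open import Data.List.Relation.Unary.All as All using (All; []; _∷_)
open import Data.List.Relation.Unary.Any using (here; there)
open import Data.Nat using (ℕ; zero; suc; _+_; _≤_; _∸_)
open import Data.Nat.ListAction using (sum)
open import Data.Nat.Properties using (suc-injective; m≤m+n; m≤n+m; ≤-trans; +-commutativeSemigroup)
open import Algebra.Properties.CommutativeSemigroup +-commutativeSemigroup using (interchange)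
open import Data.Product using (Σ-syntax; ∃-syntax; ∃₂; _×_; _,_; proj₁; proj₂)
open import Data.Sum using (_⊎_; inj₁; inj₂; map₁)
open import Relation.Nullary using (yes; no; does)
open import Relation.Nullary.Decidable using (dec-true; dec-false)
open import Relation.Binary.PropositionalEquality
  using (_≡_; _≢_; refl; sym; trans; cong; cong₂; subst; module ≡-Reasoning)

index : ∀ {n} → Vtx n → Fin n
index (orig i)   = i
index (hub i)    = i
index (wing i _) = i

other : Side → Side
other one = two
other two = one

false≢true : false ≢ true
false≢true ()

∨-≡true : ∀ a {b} → a ∨ b ≡ true → a ≡ true ⊎ b ≡ true
∨-≡true true  _ = inj₁ refl
∨-≡true false h = inj₂ h

∧-≡true : ∀ a {b} → a ∧ b ≡ true → a ≡ true × b ≡ true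
∧-≡true true h = refl , h

not-≡true : ∀ a → not a ≡ true → a ≡ false
not-≡true false _ = refl

≟-diag : ∀ {n} (i : Fin n) → does (i ≟ i) ≡ true
≟-diag i = dec-true (i ≟ i) refl

≟-≢ : ∀ {n} {i j : Fin n} → i ≢ j → does (i ≟ j) ≡ false
≟-≢ {i = i} {j} = dec-false (i ≟ j)

≟-≡true : ∀ {n} (i j : Fin n) → does (i ≟ j) ≡ true → i ≡ j
≟-≡true i j h with i ≟ j
... | yes i≡j = i≡j
... | no _    = ⊥-elim (false≢true h)

-- Invariants of the graphs in 𝒦_{n,d}

record WellFormed {n} (G : Graph n) : Set where
  field
    adj⇒present    : ∀ u v → E G u v ≡ true → present G u ≡ true
    adj-sym        : ∀ u v → E G u v ≡ E G v u
    adj-sameIndex  : ∀ u v → E G u v ≡ true → index u ≡ index v → isHub u ∨ isHub v ≡ true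
    hub-adj⇒wing   : ∀ i v → E G (hub i) v ≡ true → ∃[ s ] v ≡ wing i s
    hub-adj-wing   : ∀ i s → st G i ≡ true → E G (hub i) (wing i s) ≡ true
    assoc-adjacent : ∀ i j → i ≢ j →
      ∃₂ λ u v → assoc G i u ≡ true × assoc G j v ≡ true × E G u v ≡ true
open WellFormed

complete-wellFormed : ∀ n → WellFormed (complete n)
adj⇒present (complete-wellFormed n) (orig i) v _ = refl
adj-sym (complete-wellFormed n) (orig i) (orig j) with i ≟ j | j ≟ i
... | yes _   | yes _   = refl
... | no  _   | no  _   = refl
... | yes i≡j | no j≢i  = ⊥-elim (j≢i (sym i≡j))
... | no  i≢j | yes j≡i = ⊥-elim (i≢j (sym j≡i))
adj-sym (complete-wellFormed n) (orig _)   (hub _)    = refl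
adj-sym (complete-wellFormed n) (orig _)   (wing _ _) = refl
adj-sym (complete-wellFormed n) (hub _)    (orig _)   = refl
adj-sym (complete-wellFormed n) (hub _)    (hub _)    = refl
adj-sym (complete-wellFormed n) (hub _)    (wing _ _) = refl
adj-sym (complete-wellFormed n) (wing _ _) (orig _)   = refl
adj-sym (complete-wellFormed n) (wing _ _) (hub _)    = refl
adj-sym (complete-wellFormed n) (wing _ _) (wing _ _) = refl
adj-sameIndex (complete-wellFormed n) (orig i) (orig .i) h refl
  rewrite ≟-diag i = ⊥-elim (false≢true h)
hub-adj⇒wing (complete-wellFormed n) i v ()
hub-adj-wing (complete-wellFormed n) i s ()
assoc-adjacent (complete-wellFormed n) i j i≢j =
  orig i , orig j , ≟-diag i , ≟-diag j , cong not (≟-≢ i≢j)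

present-resp-st : ∀ {n} {G H : Graph n} → (∀ i → st G i ≡ st H i) →
  ∀ u → present G u ≡ present H u
present-resp-st st≡ (orig i)   = cong not (st≡ i)
present-resp-st st≡ (hub i)    = st≡ i
present-resp-st st≡ (wing i _) = st≡ i

assoc-resp-≗G : ∀ {n} {G H : Graph n} → G ≗G H → ∀ j u → assoc G j u ≡ assoc H j u
assoc-resp-≗G (st≡ , _) j (orig i)   = cong (λ b → not b ∧ _) (st≡ j)
assoc-resp-≗G (st≡ , _) j (hub i)    = cong (_∧ _) (st≡ j)
assoc-resp-≗G (st≡ , _) j (wing i _) = cong (_∧ _) (st≡ j)

wellFormed-resp-≗G : ∀ {n} {G H : Graph n} → G ≗G H → WellFormed G → WellFormed H
wellFormed-resp-≗G {G = G} {H} G≗H@(st≡ , E≡) wf = record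
  { adj⇒present    = λ u v h → trans (sym (present-resp-st st≡ u)) (adj⇒present wf u v (E-from h))
  ; adj-sym        = λ u v → trans (sym (E≡ u v)) (trans (adj-sym wf u v) (E≡ v u))
  ; adj-sameIndex  = λ u v h → adj-sameIndex wf u v (E-from h)
  ; hub-adj⇒wing   = λ i v h → hub-adj⇒wing wf i v (E-from h)
  ; hub-adj-wing   = λ i s h → trans (sym (E≡ _ _)) (hub-adj-wing wf i s (trans (st≡ i) h))
  ; assoc-adjacent = λ i j i≢j → let (u , v , au , av , e) = assoc-adjacent wf i j i≢j in
      u , v , trans (sym (assoc-resp-≗G G≗H i u)) au , trans (sym (assoc-resp-≗G G≗H j v)) av ,
      trans (sym (E≡ u v)) e
  }
  where
  E-from : ∀ {u v} → E H u v ≡ true → E G u v ≡ true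
  E-from {u} {v} = trans (E≡ u v)

isOrigOf-≢ : ∀ {n} {i : Fin n} u → index u ≢ i → isOrigOf i u ≡ false
isOrigOf-≢ (orig j)   j≢i = ≟-≢ j≢i
isOrigOf-≢ (hub _)    _   = refl
isOrigOf-≢ (wing _ _) _   = refl

assoc⇒index : ∀ {n} (G : Graph n) j u → assoc G j u ≡ true → index u ≡ j
assoc⇒index G j (orig x)   h = ≟-≡true x j (proj₂ (∧-≡true _ h))
assoc⇒index G j (hub x)    h = ≟-≡true x j (proj₂ (∧-≡true _ h))
assoc⇒index G j (wing x _) h = ≟-≡true x j (proj₂ (∧-≡true _ h))

assoc-unstretched : ∀ {n} (G : Graph n) {j} u → st G j ≡ false → assoc G j u ≡ true →
  u ≡ orig j
assoc-unstretched G {j} (orig x) s h rewrite s = cong orig (≟-≡true x j h)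
assoc-unstretched G (hub _)    s h rewrite s = ⊥-elim (false≢true h)
assoc-unstretched G (wing _ _) s h rewrite s = ⊥-elim (false≢true h)

assoc-stretched : ∀ {n} (G : Graph n) {j} u → st G j ≡ true → assoc G j u ≡ true →
  u ≡ hub j ⊎ ∃[ t ] u ≡ wing j t
assoc-stretched G (orig _)   s h rewrite s = ⊥-elim (false≢true h)
assoc-stretched G {j} (hub x)    s h rewrite s | ≟-≡true x j h = inj₁ refl
assoc-stretched G {j} (wing x t) s h rewrite s | ≟-≡true x j h = inj₂ (t , refl)

stretch-sym : ∀ {n} {G : Graph n} i A → (∀ u v → E G u v ≡ E G v u) →
  ∀ u v → E (stretch G i A) u v ≡ E (stretch G i A) v u
stretch-sym i A E-sym u v =
  cong₂ _∨_ (cong₂ _∧_ (E-sym u v) (∧-comm (not (isOrigOf i u)) _)) (∨-comm (newE i A u v) _)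

module StretchWellFormed {n} {G : Graph n} (wf : WellFormed G) {i : Fin n}
  {A : Side → Vtx n → Bool} (i-unstretched : st G i ≡ false)
  (Γ-split : ∀ u → E G (orig i) u ≡ (A one u ∨ A two u)) where

  G′ : Graph n
  G′ = stretch G i A

  A⇒adj : ∀ s u → A s u ≡ true → E G (orig i) u ≡ true
  A⇒adj one u a rewrite Γ-split u | a = refl
  A⇒adj two u a rewrite Γ-split u | a = ∨-zeroʳ (A one u)

  adj⇒A : ∀ u → E G (orig i) u ≡ true → ∃[ s ] A s u ≡ true
  adj⇒A u e with ∨-≡true (A one u) (trans (sym (Γ-split u)) e)
  ... | inj₁ a = one , a
  ... | inj₂ a = two , a

  isHubOf⇒≡ : ∀ v → isHubOf i v ≡ true → v ≡ hub i
  isHubOf⇒≡ (hub j) h = cong hub (≟-≡true j i h)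

  newE⇒wing : ∀ u v → newE i A u v ≡ true →
    ∃[ s ] u ≡ wing i s × (v ≡ hub i ⊎ A s v ≡ true)
  newE⇒wing (wing j s) v h with j ≟ i
  ... | yes refl = s , refl , map₁ (isHubOf⇒≡ v) (∨-≡true (isHubOf i v) h)
  ... | no _     = ⊥-elim (false≢true h)

  adj-cases : ∀ u v → E G′ u v ≡ true →
    (E G u v ≡ true × isOrigOf i u ≡ false × isOrigOf i v ≡ false)
    ⊎ newE i A u v ≡ true ⊎ newE i A v u ≡ true
  adj-cases u v h with ∨-≡true _ h
  ... | inj₂ new = inj₂ (∨-≡true _ new)
  ... | inj₁ old = let e , h′ = ∧-≡true _ old ; a , b = ∧-≡true _ h′ in
                   inj₁ (e , not-≡true _ a , not-≡true _ b)

  i-stretched : st G′ i ≡ true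
  i-stretched rewrite ≟-diag i = ∨-zeroʳ (st G i)

  present-old : ∀ u → present G u ≡ true → isOrigOf i u ≡ false → present G′ u ≡ true
  present-old (orig j)   h o rewrite o | ∨-identityʳ (st G j) = h
  present-old (hub _)    h _ rewrite h = refl
  present-old (wing _ _) h _ rewrite h = refl

  adj-orig⇒¬orig : ∀ u → E G (orig i) u ≡ true → isOrigOf i u ≡ false
  adj-orig⇒¬orig (orig j) e with j ≟ i
  ... | yes refl = ⊥-elim (false≢true (adj-sameIndex wf (orig i) (orig i) e refl))
  ... | no _     = refl
  adj-orig⇒¬orig (hub _)    _ = refl
  adj-orig⇒¬orig (wing _ _) _ = refl

  adj⇒present′ : ∀ u v → E G′ u v ≡ true → present G′ u ≡ true
  adj⇒present′ u v h with adj-cases u v h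
  ... | inj₁ (e , u≠i , _) = present-old u (adj⇒present wf u v e) u≠i
  ... | inj₂ (inj₁ new) with newE⇒wing u v new
  ...   | _ , refl , _ = i-stretched
  adj⇒present′ u v h | inj₂ (inj₂ new) with newE⇒wing v u new
  ... | _ , refl , inj₁ refl = i-stretched
  ... | s , refl , inj₂ a =
    let e = A⇒adj s u a in
    present-old u (adj⇒present wf u (orig i) (trans (adj-sym wf u (orig i)) e)) (adj-orig⇒¬orig u e)

  newE-sameIndex : ∀ u v → newE i A u v ≡ true → index u ≡ index v →
    isHub u ∨ isHub v ≡ true
  newE-sameIndex u v new eq with newE⇒wing u v new
  ... | _ , refl , inj₁ refl = refl
  ... | s , refl , inj₂ a    = adj-sameIndex wf (orig i) v (A⇒adj s v a) eq

  adj-sameIndex′ : ∀ u v → E G′ u v ≡ true → index u ≡ index v →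
    isHub u ∨ isHub v ≡ true
  adj-sameIndex′ u v h eq with adj-cases u v h
  ... | inj₁ (e , _)    = adj-sameIndex wf u v e eq
  ... | inj₂ (inj₁ new) = newE-sameIndex u v new eq
  ... | inj₂ (inj₂ new) = trans (∨-comm (isHub u) (isHub v)) (newE-sameIndex v u new (sym eq))

  hub-adj⇒wing′ : ∀ j v → E G′ (hub j) v ≡ true → ∃[ s ] v ≡ wing j s
  hub-adj⇒wing′ j v h with adj-cases (hub j) v h
  ... | inj₁ (e , _)    = hub-adj⇒wing wf j v e
  ... | inj₂ (inj₂ new) with newE⇒wing v (hub j) new
  ...   | s , refl , inj₁ refl = s , refl
  ...   | s , refl , inj₂ a
        with hub-adj⇒wing wf j (orig i) (trans (adj-sym wf (hub j) (orig i)) (A⇒adj s (hub j) a))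
  ...     | _ , ()

  hub-adj-wing′ : ∀ j s → st G′ j ≡ true → E G′ (hub j) (wing j s) ≡ true
  hub-adj-wing′ j s h with j ≟ i
  ... | yes refl = ∨-zeroʳ (E G (hub i) (wing i s) ∧ true)
  ... | no _ rewrite hub-adj-wing wf j s (trans (sym (∨-identityʳ _)) h) = refl

  assoc-old : ∀ j → j ≢ i → ∀ u → assoc G′ j u ≡ assoc G j u
  assoc-old j j≢i (orig _)   rewrite ≟-≢ j≢i | ∨-identityʳ (st G j) = refl
  assoc-old j j≢i (hub _)    rewrite ≟-≢ j≢i | ∨-identityʳ (st G j) = refl
  assoc-old j j≢i (wing _ _) rewrite ≟-≢ j≢i | ∨-identityʳ (st G j) = refl

  assoc-wing : ∀ s → assoc G′ i (wing i s) ≡ true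
  assoc-wing s rewrite ≟-diag i | ∨-zeroʳ (st G i) = refl

  adj-old : ∀ u v → E G u v ≡ true → index u ≢ i → index v ≢ i → E G′ u v ≡ true
  adj-old u v e u≢i v≢i rewrite e | isOrigOf-≢ u u≢i | isOrigOf-≢ v v≢i = refl

  adj-new : ∀ s v → A s v ≡ true → E G′ (wing i s) v ≡ true
  adj-new s v a rewrite ≟-diag i | a | ∨-zeroʳ (isHubOf i v) = ∨-zeroʳ _

  i-adjacent : ∀ j → j ≢ i →
    ∃₂ λ u v → assoc G′ i u ≡ true × assoc G′ j v ≡ true × E G′ u v ≡ true
  i-adjacent j j≢i with assoc-adjacent wf i j (λ i≡j → j≢i (sym i≡j))
  ... | u , v , au , av , e with assoc-unstretched G u i-unstretched au
  ... | refl with adj⇒A v e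
  ... | s , a = wing i s , v , assoc-wing s , trans (assoc-old j j≢i v) av , adj-new s v a

  adj-sym′ : ∀ u v → E G′ u v ≡ E G′ v u
  adj-sym′ = stretch-sym {G = G} i A (adj-sym wf)

  assoc-adjacent′ : ∀ j j′ → j ≢ j′ →
    ∃₂ λ u v → assoc G′ j u ≡ true × assoc G′ j′ v ≡ true × E G′ u v ≡ true
  assoc-adjacent′ j j′ j≢j′ with j ≟ i | j′ ≟ i
  ... | yes refl | _ = i-adjacent j′ (λ j′≡i → j≢j′ (sym j′≡i))
  ... | no _ | yes refl =
    let u , v , au , av , e = i-adjacent j j≢j′ in
    v , u , av , au , trans (adj-sym′ v u) e
  ... | no j≢i | no j′≢i =
    let u , v , au , av , e = assoc-adjacent wf j j′ j≢j′ in
    u , v , trans (assoc-old j j≢i u) au , trans (assoc-old j′ j′≢i v) av ,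
    adj-old u v e (subst (_≢ i) (sym (assoc⇒index G j u au)) j≢i)
                  (subst (_≢ i) (sym (assoc⇒index G j′ v av)) j′≢i)

  wellFormed : WellFormed G′
  wellFormed = record
    { adj⇒present    = adj⇒present′
    ; adj-sym        = adj-sym′
    ; adj-sameIndex  = adj-sameIndex′
    ; hub-adj⇒wing   = hub-adj⇒wing′
    ; hub-adj-wing   = hub-adj-wing′
    ; assoc-adjacent = assoc-adjacent′
    }

Stretches-wellFormed : ∀ {n k} {G H : Graph n} → WellFormed G → Stretches k G H → WellFormed H
Stretches-wellFormed wf (done G≗H) = wellFormed-resp-≗G G≗H wf
Stretches-wellFormed wf (step i A i-unstretched Γ-split rest) =
  Stretches-wellFormed (StretchWellFormed.wellFormed wf i-unstretched Γ-split) rest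

K-wellFormed : ∀ {n d} {G : Graph n} → K n d G → WellFormed G
K-wellFormed = Stretches-wellFormed (complete-wellFormed _)

≗G-trans : ∀ {n} {G₁ G₂ G₃ : Graph n} → G₁ ≗G G₂ → G₂ ≗G G₃ → G₁ ≗G G₃
≗G-trans (st₁ , E₁) (st₂ , E₂) =
  (λ i → trans (st₁ i) (st₂ i)) , (λ u v → trans (E₁ u v) (E₂ u v))

stretch-resp-≗G : ∀ {n} {G₁ G₂ : Graph n} i A → G₁ ≗G G₂ →
  stretch G₁ i A ≗G stretch G₂ i A
stretch-resp-≗G i A (st≡ , E≡) =
  (λ j → cong (_∨ does (j ≟ i)) (st≡ j)) ,
  (λ u v → cong (λ e → (e ∧ not (isOrigOf i u) ∧ not (isOrigOf i v))
                       ∨ newE i A u v ∨ newE i A v u)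
                (E≡ u v))

Stretches-respˡ-≗G : ∀ {n k} {G₁ G₂ H : Graph n} → G₁ ≗G G₂ →
  Stretches k G₂ H → Stretches k G₁ H
Stretches-respˡ-≗G G₁≗G₂ (done G₂≗H) = done (≗G-trans G₁≗G₂ G₂≗H)
Stretches-respˡ-≗G G₁≗G₂@(st≡ , E≡) (step i A i-unstretched Γ-split rest) =
  step i A (trans (st≡ i) i-unstretched) (λ u → trans (E≡ (orig i) u) (Γ-split u))
       (Stretches-respˡ-≗G (stretch-resp-≗G i A G₁≗G₂) rest)

absent⇒nonadjacent : ∀ {n} {G : Graph n} → WellFormed G →
  ∀ u v → present G u ≡ false → E G u v ≡ false
absent⇒nonadjacent {G = G} wf u v absent with E G u v in e
... | false = refl
... | true  = ⊥-elim (false≢true (trans (sym absent) (adj⇒present wf u v e)))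

-- Cores of partial decompositions

-- Routing the vertex set through `coreVertices` makes `coreOf G (C0 D)` definitionally `core D`.
coreVertices : ∀ {n} → Graph n → (Vtx n → Bool) → Graph n
st (coreVertices G C) i   = st G i ∧ C (hub i)
E  (coreVertices G C) _ _ = false

coreOf : ∀ {n} → Graph n → (Vtx n → Bool) → Graph n
st (coreOf G C) = st (coreVertices G C)
E  (coreOf G C) u v =
  present (coreVertices G C) u ∧ present (coreVertices G C) v ∧ E G (liftV G C u) (liftV G C v)

coreOf-sym : ∀ {n} {G : Graph n} C → (∀ u v → E G u v ≡ E G v u) →
  ∀ u v → E (coreOf G C) u v ≡ E (coreOf G C) v u
coreOf-sym {G = G} C E-sym u v
  rewrite E-sym (liftV G C u) (liftV G C v) =
    swap (present (coreVertices G C) u) (present (coreVertices G C) v) _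
  where
  swap : ∀ a b x → a ∧ b ∧ x ≡ b ∧ a ∧ x
  swap a b x = trans (sym (∧-assoc a b x)) (trans (cong (_∧ x) (∧-comm a b)) (∧-assoc b a x))

coreOf-adj⇒adj : ∀ {n} (G : Graph n) C u v → E (coreOf G C) u v ≡ true →
  E G (liftV G C u) (liftV G C v) ≡ true
coreOf-adj⇒adj G C u v h =
  let _ , h′ = ∧-≡true (present (coreVertices G C) u) h in
  proj₂ (∧-≡true (present (coreVertices G C) v) h′)

liftV≡hub : ∀ {n} (G : Graph n) C v {i} → liftV G C v ≡ hub i → v ≡ hub i
liftV≡hub G C (orig j) h with st G j | C (wing j one) | h
... | true  | true  | ()
... | true  | false | ()
... | false | _     | ()
liftV≡hub G C (hub _)    h = h
liftV≡hub G C (wing _ _) h = h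

liftV-index : ∀ {n} (G : Graph n) C v → index (liftV G C v) ≡ index v
liftV-index G C (orig j) with st G j | C (wing j one)
... | true  | true  = refl
... | true  | false = refl
... | false | _     = refl
liftV-index G C (hub _)    = refl
liftV-index G C (wing _ _) = refl

liftV-assoc : ∀ {n} (G : Graph n) C j v → assoc (coreOf G C) j v ≡ true →
  assoc G j (liftV G C v) ≡ true
liftV-assoc G C j (orig x) h with ≟-≡true x j (proj₂ (∧-≡true _ h))
... | refl with st G x in s | C (wing x one)
...   | true  | true  = cong₂ _∧_ s (≟-diag x)
...   | true  | false = cong₂ _∧_ s (≟-diag x)
...   | false | _     = cong₂ _∧_ (cong not s) (≟-diag x)
liftV-assoc G C j (hub x) h =
  let s , d = ∧-≡true (st G j ∧ C (hub j)) h in cong₂ _∧_ (proj₁ (∧-≡true (st G j) s)) d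
liftV-assoc G C j (wing x _) h =
  let s , d = ∧-≡true (st G j ∧ C (hub j)) h in cong₂ _∧_ (proj₁ (∧-≡true (st G j) s)) d

coreOf-full : ∀ {n} {G : Graph n} → WellFormed G →
  ∀ C → (∀ v → present G v ≡ true → C v ≡ true) →
  coreOf G C ≗G G
coreOf-full {G = G} wf C C-full = st-eq , E-eq
  where
  st-eq : ∀ i → st G i ∧ C (hub i) ≡ st G i
  st-eq i with st G i in s
  ... | true  = C-full (hub i) s
  ... | false = refl

  liftV-present : ∀ u → present G u ≡ true → liftV G C u ≡ u
  liftV-present (orig i)   h rewrite not-≡true _ h = refl
  liftV-present (hub _)    _ = refl
  liftV-present (wing _ _) _ = refl

  present-eq : ∀ u → present (coreVertices G C) u ≡ present G u
  present-eq = present-resp-st st-eq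

  E-eq : ∀ u v → E (coreOf G C) u v ≡ E G u v
  E-eq u v rewrite present-eq u | present-eq v
    with present G u in pu | present G v in pv
  ... | true  | true  rewrite liftV-present u pu | liftV-present v pv = refl
  ... | false | _     = sym (absent⇒nonadjacent wf u v pu)
  ... | true  | false = sym (trans (adj-sym wf u v) (absent⇒nonadjacent wf v u pv))

coreOf-hat : ∀ {n} {G : Graph n} C → HatCond G → HatCond (coreOf G C)
coreOf-hat C hat i j i≢j si sj rewrite si | sj =
  hat i j i≢j (proj₁ (∧-≡true _ si)) (proj₁ (∧-≡true _ sj))

-- Hub–wing parts and the cover condition

HubWing : ∀ {n} → Vtx n × Vtx n → Set
HubWing {n} x = ∃₂ λ (i : Fin n) p → x ≡ (hub i , wing i p)

part-hubWing : ∀ {n} {G : Graph n} {k} → WellFormed G → (D : Decomp G k) →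
  ∀ {x} → x ∈ parts D → HubWing x
part-hubWing wf D {h , w} x∈ with partsEdges D (h , w) x∈
part-hubWing wf D {hub i , w} x∈ | _ , _ , e with hub-adj⇒wing wf i w e
... | p , refl = i , p , refl

Covers : ∀ {n} → Graph n → (Vtx n → Bool) → List (Vtx n × Vtx n) → Set
Covers G C ps = ∀ v → present G v ≡ true → b2n (C v) + sum (map (occ v) ps) ≡ 1

addPart : ∀ {n} → (Vtx n → Bool) → Vtx n × Vtx n → Vtx n → Bool
addPart C (a , b) v = (eqV v a ∨ eqV v b) ∨ C v

b2n-merge : ∀ a b c m → b2n c + ((b2n a + b2n b) + m) ≡ 1 → b2n ((a ∨ b) ∨ c) + m ≡ 1
b2n-merge true  true  true  m ()
b2n-merge true  true  false m ()
b2n-merge true  false true  m ()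
b2n-merge true  false false zero _ = refl
b2n-merge false true  true  m ()
b2n-merge false true  false zero _ = refl
b2n-merge false false c m h = h

covers-addPart : ∀ {n} {G : Graph n} {C} x ps → Covers G C (x ∷ ps) → Covers G (addPart C x) ps
covers-addPart {C = C} (a , b) ps cov v pv = b2n-merge (eqV v a) (eqV v b) (C v) _ (cov v pv)

occ-hub≡occ-wings : ∀ {n} (i : Fin n) p {x} → HubWing x →
  occ (hub i) x ≡ occ (wing i p) x + occ (wing i (other p)) x
occ-hub≡occ-wings i p (j , p′ , refl) with i ≟ j
... | no _ = refl
... | yes _ with p | p′
...   | one | one = refl
...   | one | two = refl
...   | two | one = refl
...   | two | two = refl

sum-occ-hub≡sum-occ-wings : ∀ {n} (i : Fin n) p {ps} → All HubWing ps →
  sum (map (occ (hub i)) ps) ≡ sum (map (occ (wing i p)) ps) + sum (map (occ (wing i (other p))) ps)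
sum-occ-hub≡sum-occ-wings i p [] = refl
sum-occ-hub≡sum-occ-wings i p {x ∷ _} (hw ∷ hws) =
  trans (cong₂ _+_ (occ-hub≡occ-wings i p hw) (sum-occ-hub≡sum-occ-wings i p hws))
        (interchange (occ (wing i p) x) _ _ _)

occ-part-hub : ∀ {n} (i : Fin n) p → occ (hub i) (hub i , wing i p) ≡ 1
occ-part-hub i p rewrite ≟-diag i = refl

occ-part-wing : ∀ {n} (i : Fin n) p → occ (wing i p) (hub i , wing i p) ≡ 1
occ-part-wing i one rewrite ≟-diag i = refl
occ-part-wing i two rewrite ≟-diag i = refl

∈⇒≤sum-map : ∀ {A : Set} (f : A → ℕ) {x xs} → x ∈ xs → f x ≤ sum (map f xs)
∈⇒≤sum-map f {xs = y ∷ _} (here refl) = m≤m+n (f y) _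
∈⇒≤sum-map f {xs = y ∷ _} (there x∈) = ≤-trans (∈⇒≤sum-map f x∈) (m≤n+m _ (f y))

b2n-uncovered : ∀ c {m} → b2n c + m ≡ 1 → 1 ≤ m → c ≡ false × m ≡ 1
b2n-uncovered false refl _ = refl , refl
b2n-uncovered true {zero}  _ ()
b2n-uncovered true {suc _} ()

b2n-covered : ∀ c → b2n c + 0 ≡ 1 → c ≡ true
b2n-covered true _ = refl

Detached : ∀ {n} → (Vtx n → Bool) → Fin n → Side → Set
Detached C i p = C (hub i) ≡ false × C (wing i p) ≡ false × C (wing i (other p)) ≡ true

cover-detached : ∀ {n} {G : Graph n} {C ps i p} → Covers G C ps → All HubWing ps →
  st G i ≡ true → (hub i , wing i p) ∈ ps → Detached C i p
cover-detached {G = G} {C} {ps} {i} {p} cov hws sti x∈ =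
  proj₁ hub-uncovered , proj₁ p-uncovered , b2n-covered (C (wing i q)) q-covered
  where
  q = other p
  S : Vtx _ → ℕ
  S v = sum (map (occ v) ps)

  in-part : ∀ v → occ v (hub i , wing i p) ≡ 1 → 1 ≤ S v
  in-part v occ≡1 = subst (_≤ S v) occ≡1 (∈⇒≤sum-map (occ v) x∈)

  hub-uncovered : C (hub i) ≡ false × S (hub i) ≡ 1
  hub-uncovered = b2n-uncovered (C (hub i)) (cov (hub i) sti) (in-part (hub i) (occ-part-hub i p))

  p-uncovered : C (wing i p) ≡ false × S (wing i p) ≡ 1
  p-uncovered = b2n-uncovered (C (wing i p)) (cov (wing i p) sti) (in-part (wing i p) (occ-part-wing i p))

  S-q≡0 : S (wing i q) ≡ 0
  S-q≡0 = suc-injective (begin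
    1 + S (wing i q)              ≡⟨ cong (_+ S (wing i q)) (proj₂ p-uncovered) ⟨
    S (wing i p) + S (wing i q)   ≡⟨ sum-occ-hub≡sum-occ-wings i p hws ⟨
    S (hub i)                     ≡⟨ proj₂ hub-uncovered ⟩
    1                             ∎)
    where open ≡-Reasoning

  q-covered : b2n (C (wing i q)) + 0 ≡ 1
  q-covered = subst (λ m → b2n (C (wing i q)) + m ≡ 1) S-q≡0 (cov (wing i q) sti)

liftV-detached : ∀ {n} {G : Graph n} {C i} p → st G i ≡ true → Detached C i p →
  liftV G C (orig i) ≡ wing i (other p)
liftV-detached one sti (_ , C-p , _) rewrite sti | C-p = refl
liftV-detached two sti (_ , _ , C-q) rewrite sti | C-q = refl

-- Nested wing neighbourhoods

hat-rows : ∀ a b c d → b2n a + b2n b + b2n c + b2n d ≡ 1 → (a ∨ b) ∧ (c ∨ d) ≡ false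
hat-rows true  true  _     _     ()
hat-rows true  false true  _     ()
hat-rows true  false false true  ()
hat-rows true  false false false _ = refl
hat-rows false true  true  _     ()
hat-rows false true  false true  ()
hat-rows false true  false false _ = refl
hat-rows false false _     _     _ = refl

row-true : ∀ (f : Side → Side → Bool) s t → f s t ≡ true → f s one ∨ f s two ≡ true
row-true f s one e rewrite e = refl
row-true f s two e rewrite e = ∨-zeroʳ (f s one)

hat-unique-row : ∀ (f : Side → Side → Bool) →
  b2n (f one one) + b2n (f one two) + b2n (f two one) + b2n (f two two) ≡ 1 →
  ∀ p t t′ → f p t ≡ true → f (other p) t′ ≡ true → ⊥
hat-unique-row f h p t t′ e e′ = false≢true (trans (sym rows-disjoint) (rows p e e′))
  where
  rows-disjoint : (f one one ∨ f one two) ∧ (f two one ∨ f two two) ≡ false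
  rows-disjoint = hat-rows (f one one) (f one two) (f two one) (f two two) h

  rows : ∀ p → f p t ≡ true → f (other p) t′ ≡ true →
    (f one one ∨ f one two) ∧ (f two one ∨ f two two) ≡ true
  rows one e e′ = cong₂ _∧_ (row-true f one t e) (row-true f two t′ e′)
  rows two e e′ = cong₂ _∧_ (row-true f one t′ e′) (row-true f two t e)

NestedWings : ∀ {n} → Graph n → Fin n → Side → Set
NestedWings G i p =
  ∀ x → E G (wing i p) x ≡ true → x ≡ hub i ⊎ E G (wing i (other p)) x ≡ true

detached⇒nestedWings : ∀ {n} {G : Graph n} {C i} p → WellFormed G → HatCond G →
  WellFormed (coreOf G C) → st G i ≡ true → Detached C i p → NestedWings G i p
detached⇒nestedWings {G = G} {C} {i} p wf hat wf-core sti det = nested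
  where
  q = other p

  i-unstretched-in-core : st (coreOf G C) i ≡ false
  i-unstretched-in-core rewrite sti | proj₁ det = refl

  partner : ∀ j → j ≢ i → ∃[ w ] assoc G j w ≡ true × E G (wing i q) w ≡ true
  partner j j≢i with assoc-adjacent wf-core i j (λ i≡j → j≢i (sym i≡j))
  ... | u , v , au , av , e with assoc-unstretched (coreOf G C) u i-unstretched-in-core au
  ... | refl = liftV G C v , liftV-assoc G C j v av ,
               subst (λ w → E G w (liftV G C v) ≡ true) (liftV-detached {G = G} {C} p sti det)
                     (coreOf-adj⇒adj G C (orig i) v e)

  neighbour-present : ∀ x → E G (wing i p) x ≡ true → present G x ≡ true
  neighbour-present x e = adj⇒present wf x (wing i p) (trans (adj-sym wf x (wing i p)) e)

  neighbour-index : ∀ x → E G (wing i p) x ≡ true → isHub x ≡ false → index x ≢ i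
  neighbour-index x e nonhub x≡i =
    false≢true (trans (sym nonhub) (adj-sameIndex wf (wing i p) x e (sym x≡i)))

  orig-case : ∀ j → E G (wing i p) (orig j) ≡ true → E G (wing i q) (orig j) ≡ true
  orig-case j e with partner j (neighbour-index (orig j) e refl)
  ... | w , aw , e′ with assoc-unstretched G w (not-≡true (st G j) (neighbour-present (orig j) e)) aw
  ... | refl = e′

  wing-case : ∀ j t → j ≢ i → st G j ≡ true → E G (wing i p) (wing j t) ≡ true → ⊥
  wing-case j t j≢i stj e with partner j j≢i
  ... | w , aw , e′ with assoc-stretched G w stj aw
  ... | inj₁ refl with hub-adj⇒wing wf j (wing i q) (trans (adj-sym wf (hub j) (wing i q)) e′)
  ...   | _ , refl = j≢i refl
  wing-case j t j≢i stj e | w , aw , e′ | inj₂ (t′ , refl) =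
    hat-unique-row (λ s s′ → E G (wing i s) (wing j s′))
                   (hat i j (λ i≡j → j≢i (sym i≡j)) sti stj)
      p t t′ e e′

  nested : NestedWings G i p
  nested (hub j) e with hub-adj⇒wing wf j (wing i p) (trans (adj-sym wf (hub j) (wing i p)) e)
  ... | _ , refl = inj₁ refl
  nested (orig j)   e = inj₂ (orig-case j e)
  nested (wing j t) e = ⊥-elim (wing-case j t (neighbour-index (wing j t) e refl)
                                          (neighbour-present (wing j t) e) e)

-- Re-stretching the core

∧-absorbs-∨ : ∀ a x y → (a ≡ true → x ≡ true → y ≡ true) → a ∧ y ≡ (a ∧ x) ∨ (a ∧ y)
∧-absorbs-∨ false _     _ _   = refl
∧-absorbs-∨ true  false _ _   = refl
∧-absorbs-∨ true  true  y x⇒y rewrite x⇒y refl refl = refl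

module Restretch {n} {G : Graph n} (wf : WellFormed G) (C : Vtx n → Bool) {i : Fin n} (p : Side)
  (sti : st G i ≡ true) (det : Detached C i p) (nested : NestedWings G i p) where

  q : Side
  q = other p

  C′ : Vtx n → Bool
  C′ = addPart C (hub i , wing i p)

  H H′ : Graph n
  H  = coreOf G C
  H′ = coreOf G C′

  pres pres′ : Vtx n → Bool
  pres  = present (coreVertices G C)
  pres′ = present (coreVertices G C′)

  lift lift′ : Vtx n → Vtx n
  lift  = liftV G C
  lift′ = liftV G C′

  -- The paper's A_s = Γ_G(i_s) ∖ {i₀}, read through the core's labelling.
  A : Side → Vtx n → Bool
  A s v = pres v ∧ E G (wing i s) (lift v)

  i-unstretched : st H i ≡ false
  i-unstretched rewrite sti | proj₁ det = refl

  pres-orig : pres (orig i) ≡ true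
  pres-orig = cong not i-unstretched

  lift-orig : lift (orig i) ≡ wing i q
  lift-orig = liftV-detached {G = G} {C} p sti det

  nested-lift : ∀ u → pres u ≡ true →
    E G (wing i p) (lift u) ≡ true → E G (wing i q) (lift u) ≡ true
  nested-lift u pu e with nested (lift u) e
  ... | inj₂ e′ = e′
  ... | inj₁ lift≡hub with liftV≡hub G C u lift≡hub
  ...   | refl = ⊥-elim (false≢true (trans (sym i-unstretched) pu))

  Γ-split : ∀ u → E H (orig i) u ≡ (A one u ∨ A two u)
  Γ-split u rewrite pres-orig | lift-orig = by-side p (nested-lift u)
    where
    by-side : ∀ p′ → (pres u ≡ true → E G (wing i p′) (lift u) ≡ true →
                                     E G (wing i (other p′)) (lift u) ≡ true) →
              pres u ∧ E G (wing i (other p′)) (lift u) ≡ (A one u ∨ A two u)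
    by-side one = ∧-absorbs-∨ (pres u) _ _
    by-side two p⇒q = trans (∧-absorbs-∨ (pres u) _ _ p⇒q) (∨-comm (A two u) (A one u))

  st-eq : ∀ j → st (stretch H i A) j ≡ st H′ j
  st-eq j with j ≟ i
  ... | yes refl rewrite sti | proj₁ det = refl
  ... | no _ = ∨-identityʳ _

  newE-away : ∀ x v → index x ≢ i → newE i A x v ≡ false
  newE-away (orig _)   _ _   = refl
  newE-away (hub _)    _ _   = refl
  newE-away (wing _ _) _ j≢i rewrite ≟-≢ j≢i = refl

  isHubOf-away : ∀ x → index x ≢ i → isHubOf i x ≡ false
  isHubOf-away (orig _)   _   = refl
  isHubOf-away (hub _)    j≢i = ≟-≢ j≢i
  isHubOf-away (wing _ _) _   = refl

  pres-away : ∀ x → index x ≢ i → pres′ x ≡ pres x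
  pres-away (orig _)   j≢i rewrite ≟-≢ j≢i = refl
  pres-away (hub _)    j≢i rewrite ≟-≢ j≢i = refl
  pres-away (wing _ _) j≢i rewrite ≟-≢ j≢i = refl

  lift-away : ∀ x → index x ≢ i → lift′ x ≡ lift x
  lift-away (orig _)   j≢i rewrite ≟-≢ j≢i = refl
  lift-away (hub _)    _   = refl
  lift-away (wing _ _) _   = refl

  pres′-orig : pres′ (orig i) ≡ false
  pres′-orig rewrite sti | ≟-diag i = refl

  pres′-wing : ∀ s → pres′ (wing i s) ≡ true
  pres′-wing s rewrite sti | ≟-diag i = refl

  hub-nonadj-away : ∀ x → index x ≢ i → E G (hub i) x ≡ false
  hub-nonadj-away x x≢i with E G (hub i) x in e
  ... | false = refl
  ... | true with hub-adj⇒wing wf i x e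
  ...   | _ , refl = ⊥-elim (x≢i refl)

  hub-nonadj-hub : E G (hub i) (hub i) ≡ false
  hub-nonadj-hub with E G (hub i) (hub i) in e
  ... | false = refl
  ... | true with hub-adj⇒wing wf i (hub i) e
  ...   | _ , ()

  wings-nonadj : ∀ s t → E G (wing i s) (wing i t) ≡ false
  wings-nonadj s t with E G (wing i s) (wing i t) in e
  ... | false = refl
  ... | true  = ⊥-elim (false≢true (adj-sameIndex wf (wing i s) (wing i t) e refl))

  A-orig : ∀ s → A s (orig i) ≡ false
  A-orig s rewrite pres-orig | lift-orig = wings-nonadj s q

  newE-orig : ∀ v → newE i A v (orig i) ≡ false
  newE-orig (orig _)   = refl
  newE-orig (hub _)    = refl
  newE-orig (wing j t) with j ≟ i
  ... | yes refl = A-orig t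
  ... | no _     = refl

  E-orig : ∀ v → E (stretch H i A) (orig i) v ≡ E H′ (orig i) v
  E-orig v rewrite pres′-orig | ≟-diag i | newE-orig v = trans (∨-identityʳ _) (∧-zeroʳ _)

  E-away : ∀ u v → index u ≢ i → index v ≢ i → E (stretch H i A) u v ≡ E H′ u v
  E-away u v u≢i v≢i
    rewrite isOrigOf-≢ u u≢i | isOrigOf-≢ v v≢i | newE-away u v u≢i | newE-away v u v≢i
          | pres-away u u≢i | pres-away v v≢i | lift-away u u≢i | lift-away v v≢i
    = trans (∨-identityʳ _) (∧-identityʳ _)

  E-at-away : ∀ u v → index u ≡ i → index v ≢ i → E (stretch H i A) u v ≡ E H′ u v
  E-at-away (orig .i) v refl _ = E-orig v
  E-at-away (hub .i) v refl v≢i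
    rewrite newE-away v (hub i) v≢i | i-unstretched | pres-away v v≢i | lift-away v v≢i
          | hub-nonadj-away (lift v) (λ eq → v≢i (trans (sym (liftV-index G C v)) eq))
          | sti | ≟-diag i
    = sym (∧-zeroʳ (pres v))
  E-at-away (wing .i s) v refl v≢i
    rewrite newE-away v (wing i s) v≢i | isHubOf-away v v≢i | pres′-wing s
          | pres-away v v≢i | lift-away v v≢i | ≟-diag i | sti | proj₁ det
    = ∨-identityʳ _

  E-at-at : ∀ u v → index u ≡ i → index v ≡ i → E (stretch H i A) u v ≡ E H′ u v
  E-at-at (orig .i) v refl _ = E-orig v
  E-at-at (hub .i) (orig .i) refl refl rewrite sti | ≟-diag i | proj₁ det = refl
  E-at-at (hub .i) (hub .i) refl refl rewrite sti | ≟-diag i | proj₁ det | hub-nonadj-hub = refl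
  E-at-at (hub .i) (wing .i t) refl refl
    rewrite sti | ≟-diag i | proj₁ det | hub-adj-wing wf i t sti = refl
  E-at-at (wing .i s) (orig .i) refl refl rewrite A-orig s | sti | ≟-diag i | proj₁ det = refl
  E-at-at (wing .i s) (hub .i) refl refl
    rewrite sti | ≟-diag i | proj₁ det | adj-sym wf (wing i s) (hub i) | hub-adj-wing wf i s sti = refl
  E-at-at (wing .i s) (wing .i t) refl refl rewrite sti | ≟-diag i | proj₁ det | wings-nonadj s t = refl

  E-eq : ∀ u v → E (stretch H i A) u v ≡ E H′ u v
  E-eq u v with index u ≟ i | index v ≟ i
  ... | yes u≡i | yes v≡i = E-at-at u v u≡i v≡i
  ... | yes u≡i | no  v≢i = E-at-away u v u≡i v≢i
  ... | no  u≢i | no  v≢i = E-away u v u≢i v≢i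
  ... | no  u≢i | yes v≡i = begin
    E (stretch H i A) u v  ≡⟨ stretch-sym {G = H} i A (coreOf-sym C (adj-sym wf)) u v ⟩
    E (stretch H i A) v u  ≡⟨ E-at-away v u v≡i u≢i ⟩
    E H′ v u               ≡⟨ coreOf-sym C′ (adj-sym wf) v u ⟩
    E H′ u v               ∎
    where open ≡-Reasoning

  stretch≗ : stretch H i A ≗G H′
  stretch≗ = st-eq , E-eq

Restretchable : ∀ {n} → Graph n → Vtx n × Vtx n → Set
Restretchable {n} G x =
  ∃₂ λ (i : Fin n) p → x ≡ (hub i , wing i p) × st G i ≡ true × NestedWings G i p

restretchable⇒hubWing : ∀ {n} {G : Graph n} {x} → Restretchable G x → HubWing x
restretchable⇒hubWing (i , p , x≡ , _) = i , p , x≡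

restretch : ∀ {n} {G : Graph n} → WellFormed G → ∀ ps C → Covers G C ps →
  All (Restretchable G) ps → Stretches (length ps) (coreOf G C) G
restretch wf [] C cov [] = done (coreOf-full wf C (λ v pv → b2n-covered (C v) (cov v pv)))
restretch {G = G} wf (x ∷ ps) C cov (rx@(i , p , refl , sti , nested) ∷ rs) =
  step i R.A R.i-unstretched R.Γ-split
    (Stretches-respˡ-≗G R.stretch≗ (restretch wf ps (addPart C x) (covers-addPart x ps cov) rs))
  where
  det : Detached C i p
  det = cover-detached {G = G} {C} cov (All.map (restretchable⇒hubWing {G = G}) (rx ∷ rs))
                       sti (here refl)
  module R = Restretch wf C p sti det nested

lemma3p6 : ∀ (n d : ℕ) → 3 ≤ n → (G : Graph n) → KHat n d G →
    ∀ (k : ℕ) → 1 ≤ k → Deficiency n d G k →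
    Σ[ D ∈ Decomp G k ]
    (KTilde n (d ∸ k) (core D) × KHat n (d ∸ k) (core D)
    × Stretches k (core D) G)
lemma3p6 n d _ G (G∈K , hat) k _ ((D , core∈K̃) , _) =
  D , core∈K̃ , (proj₁ core∈K̃ , coreOf-hat {G = G} (C0 D) hat) ,
  subst (λ m → Stretches m (core D) G) (len D)
        (restretch wf (parts D) (C0 D) (cover D) (All.tabulate restretchable))
  where
  wf : WellFormed G
  wf = K-wellFormed G∈K

  restretchable : ∀ {x} → x ∈ parts D → Restretchable G x
  restretchable x∈ with part-hubWing wf D x∈ | partsEdges D _ x∈
  ... | i , p , refl | _ , _ , hub~wing = i , p , refl , sti ,
    detached⇒nestedWings p wf hat (K-wellFormed (proj₁ core∈K̃)) sti
      (cover-detached {G = G} {C0 D} (cover D) (All.tabulate (part-hubWing wf D)) sti x∈)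
    where
    sti : st G i ≡ true
    sti = adj⇒present wf (hub i) (wing i p) hub~wing
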